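{- Let $n,k$ be positive integers with $k\geq 3$ and $n>2k-1$. Then $V^{(k)}_{n}$ occurs exactly once as a factor of $W^{(k)}_{n-2k+1}$.
   Context: Words are over $\mathbb{N}$. Define the morphism $\varphi_k$ by $\varphi_k(ki+j)=(ki)(ki+j+1)$ if $0\le j\le k-2$ and $\varphi_k(ki+j)=(ki+j+1)$ if $j=k-1$; let $W^{(k)}_n=\varphi_k^n(0)$. For $n>2k-1$ define $V^{(k)}_n=W^{(k)}_{n-2k}W^{(k)}_{n-2k-1}\cdots W^{(k)}_{0}$ if $2k-1<n<3k-2$, and $V^{(k)}_n=W^{(k)}_{n-2k}W^{(k)}_{n-2k-1}\cdots W^{(k)}_{n-3k+3}$ if $n\ge 3k-2$ (concatenation in the indicated order). -}

module Defs where

open import Data.Nat using (ℕ; zero; suc; _+_; _*_; _∸_; _≤_; _<_; _<ᵇ_)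
open import Data.Nat.DivMod using (_%_)
open import Data.Bool using (if_then_else_)
open import Data.List using (List; []; _∷_; _++_; concatMap; length)
open import Data.Product using (Σ; _×_)
open import Relation.Binary.PropositionalEquality using (_≡_)

Word : Set
Word = List ℕ

-- The morphism φ_k on a letter a = k*i + j (0 ≤ j ≤ k-1):
--   φ_k(a) = (k*i) (a+1)   if j ≤ k-2
--   φ_k(a) = (a+1)         if j = k-1
-- For k = 0 (never used) we return the letter unchanged.
φ-letter : ℕ → ℕ → Word
φ-letter zero    a = a ∷ []
φ-letter (suc k) a =
  if (suc (a % suc k)) <ᵇ suc k
  then (a ∸ (a % suc k)) ∷ suc a ∷ []
  else suc a ∷ []

φ : ℕ → Word → Word
φ k = concatMap (φ-letter k)

W : ℕ → ℕ → Word
W k zero    = 0 ∷ []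
W k (suc n) = φ k (W k n)

Wcat : ℕ → ℕ → ℕ → Word
Wcat k lo zero    = W k lo
Wcat k lo (suc m) = W k (lo + suc m) ++ Wcat k lo m

-- V^{(k)}_n, meaningful for n > 2k-1 (and k ≥ 3):
--   n < 3k-2 : W_{n-2k} ⋯ W_0
--   n ≥ 3k-2 : W_{n-2k} ⋯ W_{n-3k+3}
V : ℕ → ℕ → Word
V k n =
  if n <ᵇ (3 * k ∸ 2)
  then Wcat k 0 (n ∸ 2 * k)
  else Wcat k (n ∸ (3 * k ∸ 3)) ((n ∸ 2 * k) ∸ (n ∸ (3 * k ∸ 3)))

OccursAt : Word → Word → ℕ → Set
OccursAt u w i = Σ Word λ x → Σ Word λ y → (length x ≡ i) × (w ≡ x ++ u ++ y)

OccursExactlyOnce : Word → Word → Set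
OccursExactlyOnce u w = Σ ℕ λ i → OccursAt u w i × (∀ j → OccursAt u w j → j ≡ i)

-- Since φ(j) = 0 (j+1) for j < k - 1, unfolding φ^{p+1}(0) one letter at a time gives
-- W_{p+1} = W_p W_{p-1} ⋯ W_{p-t} φ^{p-t}(t+1) whenever t + 1 < k.  V_n is such a product with
-- p = n - 2k, hence a prefix of W_{n-2k+1}; as V_n begins with W_p, uniqueness reduces to W_p
-- occurring in W_{p+1} only as a prefix.  That goes by induction on p: multiples of k occur in an
-- image φ(w) only as first letters of blocks, so an occurrence of φ(W_p) (which begins with 0) in
-- φ(W_{p+1}) desubstitutes to an occurrence of W_p in W_{p+1}.  The one way desubstitution can
-- fail, a single-letter last block of φ(W_p) read as the head of a two-letter block, is ruled out
-- by comparing last letters: each W_q ends with its largest letter q, which occurs nowhere else.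

module Submission where

open import Defs
open import Data.Bool using (true; false; T)
open import Data.Empty using (⊥; ⊥-elim)
open import Data.List using ([]; _∷_; _++_; _∷ʳ_; length; initLast; _∷ʳ′_)
open import Data.List.Properties
  using (++-assoc; ++-identityʳ; concatMap-++; ∷-injective; ∷-injectiveˡ;
         ∷ʳ-injective; ∷ʳ-injectiveˡ; ∷ʳ-injectiveʳ)
open import Data.List.Relation.Unary.All as All using (All; []; _∷_)
open import Data.List.Relation.Unary.All.Properties using (++⁺; ++⁻ʳ)
open import Data.Nat using (ℕ; zero; suc; _+_; _*_; _∸_; _≤_; _<_; _<ᵇ_; s≤s)
open import Data.Nat.DivMod using (_%_; _/_; m≡m%n+[m/n]*n; m*n%n≡0; [m+kn]%n≡m%n; m<n⇒m%n≡m; m%n<n)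
open import Data.Nat.Properties
open import Data.Product using (∃; ∃₂; _×_; _,_)
open import Relation.Binary.PropositionalEquality

All-inner : ∀ {A : Set} {P : A → Set} {xs z} p {a} q {c} →
            All P xs → xs ∷ʳ z ≡ p ++ a ∷ q ∷ʳ c → P a
All-inner {xs = xs} p {a} q Pxs eq = All.head (++⁻ʳ p (subst (All _) xs≡ Pxs))
  where
  xs≡ : xs ≡ p ++ a ∷ q
  xs≡ = ∷ʳ-injectiveˡ xs (p ++ a ∷ q) (trans eq (sym (++-assoc p (a ∷ q) _)))

module _ (m : ℕ) where
  private
    k : ℕ
    k = 2 + m

  data LetterView (a : ℕ) : Word → Set where
    split  : suc (a % k) < k → LetterView a ((a ∸ a % k) ∷ suc a ∷ [])
    single : suc (a % k) ≡ k → LetterView a (suc a ∷ [])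

  letterView : ∀ a → LetterView a (φ-letter k a)
  letterView a with suc (a % k) <ᵇ k in eq
  ... | true  = split (<ᵇ⇒< _ _ (subst T (sym eq) _))
  ... | false = single (≤-antisym (m%n<n a k) (≮⇒≥ λ lt → subst T eq (<⇒<ᵇ lt)))

  a∸a%k≡[a/k]*k : ∀ a → a ∸ a % k ≡ a / k * k
  a∸a%k≡[a/k]*k a = trans (cong (_∸ a % k) (m≡m%n+[m/n]*n a k)) (m+n∸m≡n (a % k) _)

  [1+a]%k≡0 : ∀ a → suc (a % k) ≡ k → suc a % k ≡ 0
  [1+a]%k≡0 a eq = trans (cong (_% k) suc-a≡) (m*n%n≡0 (suc (a / k)) k)
    where
    suc-a≡ : suc a ≡ suc (a / k) * k
    suc-a≡ = trans (cong suc (m≡m%n+[m/n]*n a k)) (cong (_+ a / k * k) eq)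

  φ-letter-head-multiple : ∀ a r {c s} → φ-letter k a ++ r ≡ c ∷ s → c % k ≡ 0
  φ-letter-head-multiple a r eq with φ-letter k a | letterView a
  φ-letter-head-multiple a r refl | _ | split _   = trans (cong (_% k) (a∸a%k≡[a/k]*k a)) (m*n%n≡0 (a / k) k)
  φ-letter-head-multiple a r refl | _ | single eq = [1+a]%k≡0 a eq

  [1+a]%k≢0 : ∀ a → suc (a % k) < k → suc a % k ≢ 0
  [1+a]%k≢0 a lt eq = 0≢1+n (trans (sym eq) suc-%≡)
    where
    suc-%≡ : suc a % k ≡ suc (a % k)
    suc-%≡ = trans (cong (λ b → suc b % k) (m≡m%n+[m/n]*n a k))
                   (trans ([m+kn]%n≡m%n (suc (a % k)) (a / k) k) (m<n⇒m%n≡m lt))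

  -- Cutting φ w just before a multiple of k cuts between blocks, since the second letter a + 1
  -- of a two-letter block is never a multiple of k.
  φ-desubstitute : ∀ w x {c y} → φ k w ≡ x ++ c ∷ y → c % k ≡ 0 →
             ∃₂ λ w₁ w₂ → w ≡ w₁ ++ w₂ × x ≡ φ k w₁ × φ k w₂ ≡ c ∷ y
  φ-desubstitute []      []      ()
  φ-desubstitute []      (_ ∷ _) ()
  φ-desubstitute (a ∷ w) []      eq c%k = [] , a ∷ w , refl , refl , eq
  φ-desubstitute (a ∷ w) (b ∷ x) eq c%k with φ-letter k a in e | letterView a
  ... | _ | single _ with refl , eq′ ← ∷-injective eq
                    with w₁ , w₂ , w≡ , x≡ , φw₂≡ ← φ-desubstitute w x eq′ c%k
    = a ∷ w₁ , w₂ , cong (a ∷_) w≡ , trans (cong (suc a ∷_) x≡) (cong (_++ φ k w₁) (sym e)) , φw₂≡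
  ... | _ | split lt with refl , eq′ ← ∷-injective eq with x
  ...   | [] with refl , _ ← ∷-injective eq′ = ⊥-elim ([1+a]%k≢0 a lt c%k)
  ...   | _ ∷ x′ with refl , eq″ ← ∷-injective eq′
                 with w₁ , w₂ , w≡ , x′≡ , φw₂≡ ← φ-desubstitute w x′ eq″ c%k
    = a ∷ w₁ , w₂ , cong (a ∷_) w≡ ,
      trans (cong (λ z → b ∷ suc a ∷ z) x′≡) (cong (_++ φ k w₁) (sym e)) , φw₂≡

  φ-head-multiple : ∀ w {c s} → φ k w ≡ c ∷ s → c % k ≡ 0
  φ-head-multiple (a ∷ w) eq = φ-letter-head-multiple a (φ k w) eq

  -- In the overhang case the last block φ ℓ = (ℓ + 1) of φ u is the head a ∸ a % k of φ a.
  data φ-Prefix (u w : Word) : Set where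
    aligned  : ∀ w′ → w ≡ u ++ w′ → φ-Prefix u w
    overhang : ∀ u₀ ℓ a w′ → u ≡ u₀ ∷ʳ ℓ → w ≡ u₀ ++ a ∷ w′ → ℓ < a →
               φ-letter k ℓ ≡ suc ℓ ∷ [] → φ-Prefix u w

  φ-Prefix-∷ : ∀ b {u w} → φ-Prefix u w → φ-Prefix (b ∷ u) (b ∷ w)
  φ-Prefix-∷ b (aligned w′ w≡)                 = aligned w′ (cong (b ∷_) w≡)
  φ-Prefix-∷ b (overhang u₀ ℓ a w′ u≡ w≡ ℓ<a φℓ≡) =
    overhang (b ∷ u₀) ℓ a w′ (cong (b ∷_) u≡) (cong (b ∷_) w≡) ℓ<a φℓ≡

  φ-prefix : ∀ u w {y} → φ k w ≡ φ k u ++ y → φ-Prefix u w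
  φ-prefix []      w  _ = aligned w refl
  φ-prefix (b ∷ u) [] eq with φ-letter k b | letterView b
  φ-prefix (b ∷ u) [] () | _ | split _
  φ-prefix (b ∷ u) [] () | _ | single _
  φ-prefix (b ∷ u) (a ∷ w) {y} eq
    with φ-letter k a | letterView a | φ-letter k b in φb≡ | letterView b
  ... | _ | split _  | _ | split _  with _ , eq′ ← ∷-injective eq with refl , eq″ ← ∷-injective eq′
    = φ-Prefix-∷ b (φ-prefix u w eq″)
  ... | _ | single _ | _ | single _ with refl , eq′ ← ∷-injective eq
    = φ-Prefix-∷ b (φ-prefix u w eq′)
  ... | _ | single _ | _ | split lt with _ , eq′ ← ∷-injective eq
    = ⊥-elim ([1+a]%k≢0 b lt (φ-head-multiple w eq′))
  ... | _ | split lt | _ | single _ with head≡ , eq′ ← ∷-injective eq with u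
  ...   | []     = overhang [] b a w refl refl (subst (_≤ a) head≡ (m∸n≤m a (a % k))) φb≡
  ...   | c ∷ u₂ = ⊥-elim ([1+a]%k≢0 a lt
                     (φ-letter-head-multiple c (φ k u₂ ++ y) (trans (sym (++-assoc _ (φ k u₂) y)) (sym eq′))))

  φ-++ : ∀ u v → φ k (u ++ v) ≡ φ k u ++ φ k v
  φ-++ = concatMap-++ (φ-letter k)

  φ-∷ʳ : ∀ u a → φ k (u ∷ʳ a) ≡ φ k u ++ φ-letter k a
  φ-∷ʳ u a = trans (φ-++ u (a ∷ [])) (cong (φ k u ++_) (++-identityʳ _))

  φ-letter-last : ∀ a → ∃ λ t → φ-letter k a ≡ t ∷ʳ suc a × All (_≤ a) t
  φ-letter-last a with φ-letter k a | letterView a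
  ... | _ | split _  = (a ∸ a % k) ∷ [] , refl , m∸n≤m a (a % k) ∷ []
  ... | _ | single _ = [] , refl , []

  φ-bounded : ∀ {n} w → All (_< n) w → All (_< suc n) (φ k w)
  φ-bounded []      []          = []
  φ-bounded (a ∷ w) (a<n ∷ w<n) with φ-letter k a | letterView a
  ... | _ | split _  = s≤s (≤-trans (m∸n≤m a (a % k)) (<⇒≤ a<n)) ∷ s≤s a<n ∷ φ-bounded w w<n
  ... | _ | single _ = s≤s a<n ∷ φ-bounded w w<n

  φ[u]≡w++u⇒u≡[] : ∀ u w → φ k u ≡ w ++ u → u ≡ []
  φ[u]≡w++u⇒u≡[] u w eq with initLast u
  ... | []       = refl
  ... | u₁ ∷ʳ′ s with t , φs≡ , _ ← φ-letter-last s =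
    ⊥-elim (1+n≢n (∷ʳ-injectiveʳ (φ k u₁ ++ t) (w ++ u₁) last-letters))
    where
    open ≡-Reasoning
    last-letters : (φ k u₁ ++ t) ∷ʳ suc s ≡ (w ++ u₁) ∷ʳ s
    last-letters = begin
      (φ k u₁ ++ t) ∷ʳ suc s   ≡⟨ ++-assoc (φ k u₁) t _ ⟩
      φ k u₁ ++ t ∷ʳ suc s     ≡⟨ cong (φ k u₁ ++_) φs≡ ⟨
      φ k u₁ ++ φ-letter k s   ≡⟨ φ-∷ʳ u₁ s ⟨
      φ k (u₁ ∷ʳ s)            ≡⟨ eq ⟩
      w ++ u₁ ∷ʳ s             ≡⟨ ++-assoc w u₁ _ ⟨
      (w ++ u₁) ∷ʳ s           ∎

  W-head : ∀ n → ∃ λ t → W k n ≡ 0 ∷ t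
  W-head zero    = [] , refl
  W-head (suc n) with t , W≡ ← W-head n = 1 ∷ φ k t , cong (φ k) W≡

  W-suc-∷ʳ : ∀ n I → W k n ≡ I ∷ʳ n → W k (suc n) ≡ φ k I ++ φ-letter k n
  W-suc-∷ʳ n I W≡ = trans (cong (φ k) W≡) (φ-∷ʳ I n)

  W-last : ∀ n → ∃ λ I → W k n ≡ I ∷ʳ n × All (_< n) I
  W-last zero = [] , refl , []
  W-last (suc n) with I , W≡ , I<n ← W-last n | t , φn≡ , t≤n ← φ-letter-last n =
    φ k I ++ t ,
    trans (W-suc-∷ʳ n I W≡) (trans (cong (φ k I ++_) φn≡) (sym (++-assoc (φ k I) t _))) ,
    ++⁺ (φ-bounded I I<n) (All.map s≤s t≤n)

  W-inner-letter : ∀ n p {a} q {c} → W k n ≡ p ++ a ∷ q ∷ʳ c → a < n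
  W-inner-letter n p q eq with I , W≡ , I<n ← W-last n = All-inner p q I<n (trans (sym W≡) eq)

  W-no-overhang : ∀ n w₁ I a w′ → W k n ≡ I ∷ʳ n → W k (suc n) ≡ w₁ ++ I ++ a ∷ w′ →
                  n < a → φ-letter k n ≡ suc n ∷ [] → ⊥
  W-no-overhang n w₁ I a w′ Wn≡ W≡ n<a φn≡
    with φI∷ʳ≡ ← trans (W-suc-∷ʳ n I Wn≡) (cong (φ k I ++_) φn≡)
    with initLast w′
  ... | q ∷ʳ′ _ =
    <⇒≱ n<a (≤-pred (W-inner-letter (suc n) (w₁ ++ I) q (trans W≡ (sym (++-assoc w₁ I _)))))
  ... | []
    with refl ← φ[u]≡w++u⇒u≡[] I w₁ (∷ʳ-injectiveˡ (φ k I) (w₁ ++ I)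
                  (trans (sym φI∷ʳ≡) (trans W≡ (sym (++-assoc w₁ I _)))))
    with t , W≡0∷t ← W-head n
    with refl ← ∷-injectiveˡ (trans (sym Wn≡) W≡0∷t)
    with () ← φn≡

  W-occurs-in-successor-only-at-0 : ∀ n x y → W k (suc n) ≡ x ++ W k n ++ y → x ≡ []
  W-occurs-in-successor-only-at-0 zero []                  y eq = refl
  W-occurs-in-successor-only-at-0 zero (_ ∷ [])            y ()
  W-occurs-in-successor-only-at-0 zero (_ ∷ _ ∷ [])        y ()
  W-occurs-in-successor-only-at-0 zero (_ ∷ _ ∷ _ ∷ _)     y ()
  W-occurs-in-successor-only-at-0 (suc n) x y eq
    with t , W≡0∷t ← W-head n
    with w₁ , w₂ , W≡ , x≡ , φw₂≡ ← φ-desubstitute (W k (suc n)) x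
                                      (trans eq (cong (λ v → x ++ φ k v ++ y) W≡0∷t)) refl
    with φ-prefix (W k n) w₂ (trans φw₂≡ (cong (λ v → φ k v ++ y) (sym W≡0∷t)))
  ... | aligned w′ w₂≡ =
    trans x≡ (cong (φ k) (W-occurs-in-successor-only-at-0 n w₁ w′ (trans W≡ (cong (w₁ ++_) w₂≡))))
  ... | overhang u₀ ℓ a w′ Wn≡ w₂≡ ℓ<a φℓ≡
    with I , Wn≡I , _ ← W-last n
    with refl , refl ← ∷ʳ-injective u₀ I (trans (sym Wn≡) Wn≡I) =
    ⊥-elim (W-no-overhang n w₁ u₀ a w′ Wn≡ (trans W≡ (cong (w₁ ++_) w₂≡)) ℓ<a φℓ≡)

  φ^ : ℕ → Word → Word
  φ^ zero    w = w
  φ^ (suc a) w = φ k (φ^ a w)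

  W≡φ^ : ∀ a → W k a ≡ φ^ a (0 ∷ [])
  W≡φ^ zero    = refl
  W≡φ^ (suc a) = cong (φ k) (W≡φ^ a)

  φ^-++ : ∀ a u v → φ^ a (u ++ v) ≡ φ^ a u ++ φ^ a v
  φ^-++ zero    u v = refl
  φ^-++ (suc a) u v = trans (cong (φ k) (φ^-++ a u v)) (φ-++ (φ^ a u) (φ^ a v))

  φ^-suc : ∀ a w → φ^ (suc a) w ≡ φ^ a (φ k w)
  φ^-suc zero    w = refl
  φ^-suc (suc a) w = cong (φ k) (φ^-suc a w)

  φ-letter-small : ∀ j → suc j < k → φ-letter k j ≡ 0 ∷ suc j ∷ []
  φ-letter-small j sj<k with j%k≡j ← m<n⇒m%n≡m (<-trans (n<1+n j) sj<k)
                          with φ-letter k j | letterView j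
  ... | _ | split _  = cong (λ i → i ∷ suc j ∷ []) (trans (cong (j ∸_) j%k≡j) (n∸n≡0 j))
  ... | _ | single sj≡k = ⊥-elim (<-irrefl (trans (cong suc (sym j%k≡j)) sj≡k) sj<k)

  φ^-suc-small : ∀ a j → suc j < k → φ^ (suc a) (j ∷ []) ≡ W k a ++ φ^ a (suc j ∷ [])
  φ^-suc-small a j sj<k = begin
    φ^ (suc a) (j ∷ [])                   ≡⟨ φ^-suc a (j ∷ []) ⟩
    φ^ a (φ-letter k j ++ [])             ≡⟨ cong (φ^ a) (trans (++-identityʳ _) (φ-letter-small j sj<k)) ⟩
    φ^ a (0 ∷ suc j ∷ [])                 ≡⟨ φ^-++ a (0 ∷ []) (suc j ∷ []) ⟩
    φ^ a (0 ∷ []) ++ φ^ a (suc j ∷ [])    ≡⟨ cong (_++ φ^ a (suc j ∷ [])) (W≡φ^ a) ⟨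
    W k a ++ φ^ a (suc j ∷ [])            ∎
    where open ≡-Reasoning

  φ^-Wcat : ∀ lo t j → suc (j + t) < k →
            φ^ (suc (lo + t)) (j ∷ []) ≡ Wcat k lo t ++ φ^ lo (suc (j + t) ∷ [])
  φ^-Wcat lo zero j lt rewrite +-identityʳ lo | +-identityʳ j = φ^-suc-small lo j lt
  φ^-Wcat lo (suc t) j lt = begin
    φ^ (suc (lo + suc t)) (j ∷ [])
      ≡⟨ φ^-suc-small (lo + suc t) j (≤-<-trans (s≤s (m≤m+n j (suc t))) lt) ⟩
    W k (lo + suc t) ++ φ^ (lo + suc t) (suc j ∷ [])
      ≡⟨ cong (λ a → W k (lo + suc t) ++ φ^ a (suc j ∷ [])) (+-suc lo t) ⟩
    W k (lo + suc t) ++ φ^ (suc (lo + t)) (suc j ∷ [])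
      ≡⟨ cong (W k (lo + suc t) ++_) (φ^-Wcat lo t (suc j) (subst (λ i → suc i < k) (+-suc j t) lt)) ⟩
    W k (lo + suc t) ++ Wcat k lo t ++ φ^ lo (suc (suc j + t) ∷ [])
      ≡⟨ ++-assoc (W k (lo + suc t)) (Wcat k lo t) _ ⟨
    Wcat k lo (suc t) ++ φ^ lo (suc (suc j + t) ∷ [])
      ≡⟨ cong (λ i → Wcat k lo (suc t) ++ φ^ lo (suc i ∷ [])) (+-suc j t) ⟨
    Wcat k lo (suc t) ++ φ^ lo (suc (j + suc t) ∷ [])
      ∎
    where open ≡-Reasoning

  Wcat-head : ∀ lo t → ∃ λ R → Wcat k lo t ≡ W k (lo + t) ++ R
  Wcat-head lo zero    = [] , trans (cong (W k) (sym (+-identityʳ lo))) (sym (++-identityʳ _))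
  Wcat-head lo (suc t) = Wcat k lo t , refl

  Wcat-occursExactlyOnce : ∀ lo t → suc t < k → OccursExactlyOnce (Wcat k lo t) (W k (suc (lo + t)))
  Wcat-occursExactlyOnce lo t st<k = 0 , ([] , φ^ lo (suc t ∷ []) , refl , W≡Wcat++) , only-at-0
    where
    W≡Wcat++ : W k (suc (lo + t)) ≡ Wcat k lo t ++ φ^ lo (suc t ∷ [])
    W≡Wcat++ = trans (W≡φ^ (suc (lo + t))) (φ^-Wcat lo t 0 st<k)
    only-at-0 : ∀ i → OccursAt (Wcat k lo t) (W k (suc (lo + t))) i → i ≡ 0
    only-at-0 i (x , y , |x|≡i , W≡) with R , Wcat≡ ← Wcat-head lo t =
      trans (sym |x|≡i) (cong length (W-occurs-in-successor-only-at-0 (lo + t) x (R ++ y)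
        (trans W≡ (cong (x ++_) (trans (cong (_++ y) Wcat≡) (++-assoc (W k (lo + t)) R y))))))

m∸n≡1+[m∸1+n] : ∀ {m n} → n < m → m ∸ n ≡ suc (m ∸ suc n)
m∸n≡1+[m∸1+n] (s≤s n≤m) = +-∸-assoc 1 n≤m

3k∸2≡2k+1+j : ∀ j → 3 * (3 + j) ∸ 2 ≡ 2 * (3 + j) + suc j
3k∸2≡2k+1+j j = trans (cong suc (+-comm j (2 * (3 + j)))) (sym (+-suc (2 * (3 + j)) j))

V≡Wcat : ∀ k n → 3 ≤ k → 2 * k ≤ n →
         ∃₂ λ lo t → suc t < k × lo + t ≡ n ∸ 2 * k × V k n ≡ Wcat k lo t
V≡Wcat 1 _ (s≤s ()) _
V≡Wcat 2 _ (s≤s (s≤s ())) _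
V≡Wcat k@(suc (suc (suc j))) n _ 2k≤n with n <ᵇ 3 * k ∸ 2 in n<ᵇ≡
... | true  = 0 , p , s≤s (s≤s (<⇒≤ p<1+j)) , refl , refl
  where
  p : ℕ
  p = n ∸ 2 * k
  p<1+j : p < suc j
  p<1+j = +-cancelˡ-< (2 * k) p (suc j)
            (subst₂ _<_ (sym (m+[n∸m]≡n 2k≤n)) (3k∸2≡2k+1+j j) (<ᵇ⇒< n _ (subst T (sym n<ᵇ≡) _)))
... | false = lo , p ∸ lo , subst (λ t → suc t < k) (sym t≡j) (s≤s (s≤s (n≤1+n j))) , lo+t≡p , refl
  where
  p lo : ℕ
  p = n ∸ 2 * k
  lo = n ∸ (3 * k ∸ 3)
  1+j≤p : suc j ≤ p
  1+j≤p = +-cancelˡ-≤ (2 * k) (suc j) p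
            (subst₂ _≤_ (3k∸2≡2k+1+j j) (sym (m+[n∸m]≡n 2k≤n)) (≮⇒≥ λ lt → subst T n<ᵇ≡ (<⇒<ᵇ lt)))
  lo≡p∸j : lo ≡ p ∸ j
  lo≡p∸j = trans (cong (n ∸_) (+-comm j (2 * k))) (sym (∸-+-assoc n (2 * k) j))
  t≡j : p ∸ lo ≡ j
  t≡j = trans (cong (p ∸_) lo≡p∸j) (m∸[m∸n]≡n (<⇒≤ 1+j≤p))
  lo+t≡p : lo + (p ∸ lo) ≡ p
  lo+t≡p = trans (cong₂ _+_ lo≡p∸j t≡j) (m∸n+n≡m (<⇒≤ 1+j≤p))

lemma25 : (n k : ℕ) → 1 ≤ n → 3 ≤ k → 2 * k ∸ 1 < n →
    OccursExactlyOnce (V k n) (W k (n ∸ (2 * k ∸ 1)))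
lemma25 _ 1 _ (s≤s ()) _
-- For k ≥ 1 the hypothesis 2 * k ∸ 1 < n unfolds to 2 * k ≤ n.
lemma25 n k@(suc (suc m)) _ 3≤k 2k∸1<n
  with lo , t , 1+t<k , lo+t≡ , V≡Wcat′ ← V≡Wcat k n 3≤k 2k∸1<n =
  subst₂ OccursExactlyOnce (sym V≡Wcat′) (cong (W k) W-index≡) (Wcat-occursExactlyOnce m lo t 1+t<k)
  where
  W-index≡ : suc (lo + t) ≡ n ∸ (2 * k ∸ 1)
  W-index≡ = trans (cong suc lo+t≡) (sym (m∸n≡1+[m∸1+n] 2k∸1<n))
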